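{- Let $n$ be a positive integer with $6\mid n$ which is either near superperfect or deficient superperfect. Then $n=2^m a$ for some integer $m\ge1$ and some odd perfect square $a$.
   Context: $\sigma(m)$ denotes the sum of the positive divisors of $m$. A positive integer $n$ is near superperfect if $2n+d=\sigma(\sigma(n))$ for some positive divisor $d$ of $n$, and deficient superperfect if $2n-d=\sigma(\sigma(n))$ for some positive divisor $d$ of $n$. -}

module Defs where

open import Data.Nat using (ℕ; suc; _+_; _*_; _<_)
open import Data.Nat.Divisibility using (_∣_; _∣?_)
open import Data.List using (List; filter; applyUpTo)
open import Data.Nat.ListAction using (sum)
open import Data.Product using (Σ; _×_)
open import Relation.Binary.PropositionalEquality using (_≡_)

divisors : ℕ → List ℕ
divisors m = filter (_∣? m) (applyUpTo suc m)

σ : ℕ → ℕ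
σ m = sum (divisors m)

NearSuperperfect : ℕ → Set
NearSuperperfect n = Σ ℕ λ d → (0 < d) × (d ∣ n) × (2 * n + d ≡ σ (σ n))

-- deficient superperfect: 2n - d = σ(σ(n)) for some positive divisor d of n,
-- written without truncated subtraction as 2n = σ(σ(n)) + d
DeficientSuperperfect : ℕ → Set
DeficientSuperperfect n = Σ ℕ λ d → (0 < d) × (d ∣ n) × (2 * n ≡ σ (σ n) + d)

-- If σ(n) were even, say σ(n) = 2t, then t ≥ n, because 6 ∣ n gives σ(n) ≥ (n/6)·σ(6) = 2n;
-- and then σ(σ(n)) = σ(2t) > t·σ(2) = 3t ≥ 3n, whereas either hypothesis forces
-- σ(σ(n)) ≤ 3n. So σ(n) is odd. Write n = 2^m a with a odd. Then σ(n) has the parity of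
-- the sum of the odd divisors of n, which are the divisors of a. The involution d ↦ a/d
-- pairs them off into pairs of odd numbers, each with even sum, so it must have a fixed
-- point d = a/d, and a = d².
module Submission where

open import Data.List using (List; []; _∷_; filter; applyUpTo; map; length)
open import Data.List.Properties using (filter-accept; filter-reject)
open import Data.List.Membership.Propositional using (_∈_; lose)
open import Data.List.Membership.Propositional.Properties
  using (∈-∃++; ∈-filter⁺; ∈-filter⁻; ∈-applyUpTo⁺; ∈-map⁻)
open import Data.List.Relation.Binary.Permutation.Propositional using (_↭_; prep; ↭-sym; ↭⇒↭ₛ)
open import Data.List.Relation.Binary.Permutation.Propositional.Properties
  using (shift; ∈-resp-↭; ↭-length)
import Data.List.Relation.Binary.Permutation.Setoid.Properties as Permutationₛ
open import Data.List.Relation.Binary.Subset.Propositional using (_⊆_)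
open import Data.List.Relation.Unary.All as All using (_∷_)
open import Data.List.Relation.Unary.AllPairs as AllPairs using (_∷_)
open import Data.List.Relation.Unary.Any as Any using (here; there; any?; satisfied)
open import Data.List.Relation.Unary.Unique.Propositional using (Unique)
import Data.List.Relation.Unary.Unique.Propositional.Properties as Unique
open import Data.Nat
open import Data.Nat.DivMod using (m*[n/m]≡n; m*n/n≡m)
open import Data.Nat.Divisibility
open import Data.Nat.Induction using (<-wellFounded)
open import Data.Nat.ListAction using (sum)
open import Data.Nat.ListAction.Properties using (sum-↭)
open import Data.Nat.Properties
open import Algebra.Properties.CommutativeSemigroup +-commutativeSemigroup using (interchange; x∙yz≈y∙xz)
open import Data.Product using (Σ; ∃; ∃₂; _×_; _,_; proj₁; proj₂; map₂)
open import Data.Sum using (_⊎_; inj₁; inj₂)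
open import Function using (_∘_)
open import Induction.WellFounded using (Acc; acc)
open import Relation.Binary.PropositionalEquality
open import Relation.Nullary using (¬_; ¬?; yes; no; contradiction)
open import Relation.Unary using (Decidable)

open import Defs

private
  variable
    a d e m n x y : ℕ
    xs ys : List ℕ

∈⇒↭∷ : x ∈ xs → ∃ λ ys → xs ↭ x ∷ ys
∈⇒↭∷ x∈xs with ys , zs , refl ← ∈-∃++ x∈xs = _ , shift _ ys zs

Unique-resp-↭ : xs ↭ ys → Unique xs → Unique ys
Unique-resp-↭ = Permutationₛ.Unique-resp-↭ (setoid ℕ) ∘ ↭⇒↭ₛ

sum-mono-⊆ : Unique xs → xs ⊆ ys → sum xs ≤ sum ys
sum-mono-⊆ {[]} _ _ = z≤n
sum-mono-⊆ {x ∷ xs} {ys} (x∉xs ∷ u) xs⊆ys with zs , ys↭x∷zs ← ∈⇒↭∷ (xs⊆ys (here refl)) =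
  begin
    x + sum xs ≤⟨ +-monoʳ-≤ x (sum-mono-⊆ u xs⊆zs) ⟩
    x + sum zs ≡⟨ sum-↭ ys↭x∷zs ⟨
    sum ys     ∎
  where
  open ≤-Reasoning
  xs⊆zs : xs ⊆ zs
  xs⊆zs y∈xs = Any.tail (All.lookup x∉xs y∈xs ∘ sym) (∈-resp-↭ ys↭x∷zs (xs⊆ys (there y∈xs)))

sum-map-* : ∀ k xs → sum (map (k *_) xs) ≡ k * sum xs
sum-map-* k [] = sym (*-zeroʳ k)
sum-map-* k (x ∷ xs) = trans (cong (k * x +_) (sum-map-* k xs)) (sym (*-distribˡ-+ k x (sum xs)))

record FixedPointFreeInvolution (ι : ℕ → ℕ) (xs : List ℕ) : Set where
  field
    closed         : ∀ {x} → x ∈ xs → ι x ∈ xs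
    involutive     : ∀ {x} → x ∈ xs → ι (ι x) ≡ x
    fixedPointFree : ∀ {x} → x ∈ xs → ι x ≢ x

module _ {ι : ℕ → ℕ} where
  open FixedPointFreeInvolution

  fixedPointFreeInvolution-resp-↭ : xs ↭ ys →
    FixedPointFreeInvolution ι xs → FixedPointFreeInvolution ι ys
  fixedPointFreeInvolution-resp-↭ {xs} {ys} xs↭ys inv = record
    { closed         = λ x∈ys → ∈-resp-↭ xs↭ys (closed inv (back x∈ys))
    ; involutive     = involutive inv ∘ back
    ; fixedPointFree = fixedPointFree inv ∘ back
    }
    where
    back : ys ⊆ xs
    back = ∈-resp-↭ (↭-sym xs↭ys)

  fixedPointFreeInvolution-drop-pair : Unique (x ∷ ι x ∷ xs) →
    FixedPointFreeInvolution ι (x ∷ ι x ∷ xs) → FixedPointFreeInvolution ι xs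
  fixedPointFreeInvolution-drop-pair {x} {xs} ((_ ∷ x∉xs) ∷ (ιx∉xs ∷ _)) inv = record
    { closed         = closed′
    ; involutive     = involutive inv ∘ there ∘ there
    ; fixedPointFree = fixedPointFree inv ∘ there ∘ there
    }
    where
    closed′ : ∀ {y} → y ∈ xs → ι y ∈ xs
    closed′ {y} y∈xs with closed inv (there (there y∈xs))
    ... | here ιy≡x = contradiction (trans (sym (involutive inv (there (there y∈xs)))) (cong ι ιy≡x))
                                    (All.lookup ιx∉xs y∈xs ∘ sym)
    ... | there (here ιy≡ιx) = contradiction (trans (sym (involutive inv (there (there y∈xs))))
                                                    (trans (cong ι ιy≡ιx) (involutive inv (here refl))))
                                             (All.lookup x∉xs y∈xs ∘ sym)
    ... | there (there ιy∈xs) = ιy∈xs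

  2∣sum-of-pairs : Unique xs → FixedPointFreeInvolution ι xs → (∀ {x} → x ∈ xs → 2 ∣ x + ι x) →
                   2 ∣ sum xs
  2∣sum-of-pairs {xs} = go xs (<-wellFounded (length xs))
    where
    go : ∀ xs → Acc _<_ (length xs) → Unique xs → FixedPointFreeInvolution ι xs →
         (∀ {x} → x ∈ xs → 2 ∣ x + ι x) → 2 ∣ sum xs
    go [] _ _ _ _ = 2 ∣0
    go (x ∷ xs) (acc rs) u inv even
      with zs , xs↭ιx∷zs ← ∈⇒↭∷ (Any.tail (fixedPointFree inv (here refl)) (closed inv (here refl))) =
      subst (2 ∣_) (sym sum-split)
        (∣m∣n⇒∣m+n (even (here refl)) (go zs (rs shorter) (AllPairs.tail (AllPairs.tail u′)) invᶻ evenᶻ))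
      where
      perm : x ∷ xs ↭ x ∷ ι x ∷ zs
      perm = prep x xs↭ιx∷zs
      u′ : Unique (x ∷ ι x ∷ zs)
      u′ = Unique-resp-↭ perm u
      invᶻ : FixedPointFreeInvolution ι zs
      invᶻ = fixedPointFreeInvolution-drop-pair u′ (fixedPointFreeInvolution-resp-↭ perm inv)
      evenᶻ : ∀ {y} → y ∈ zs → 2 ∣ y + ι y
      evenᶻ = even ∘ ∈-resp-↭ (↭-sym perm) ∘ there ∘ there
      shorter : length zs < length (x ∷ xs)
      shorter = subst (λ l → length zs < suc l) (sym (↭-length xs↭ιx∷zs)) (m<n⇒m<1+n (n<1+n _))
      sum-split : sum (x ∷ xs) ≡ (x + ι x) + sum zs
      sum-split = trans (cong (x +_) (sum-↭ xs↭ιx∷zs)) (sym (+-assoc x (ι x) (sum zs)))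

∈-divisors⁺ : .{{NonZero n}} → d ∣ n → d ∈ divisors n
∈-divisors⁺ {n} {zero} 0∣n = contradiction (0∣⇒≡0 0∣n) (≢-nonZero⁻¹ n)
∈-divisors⁺ {n} {suc d} d∣n = ∈-filter⁺ (_∣? n) (∈-applyUpTo⁺ suc (∣⇒≤ d∣n)) d∣n

∈-divisors⁻ : d ∈ divisors n → d ∣ n
∈-divisors⁻ {n = n} d∈ = proj₂ (∈-filter⁻ (_∣? n) {xs = applyUpTo suc n} d∈)

∈-divisors⇒nonZero : d ∈ divisors n → NonZero n
∈-divisors⇒nonZero {n = suc _} _ = _

divisors-unique : ∀ n → Unique (divisors n)
divisors-unique n = Unique.filter⁺ (_∣? n) (Unique.applyUpTo⁺₁ suc n (λ i<j _ → <⇒≢ i<j ∘ suc-injective))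

map-*-divisors⊆divisors : ∀ k .{{_ : NonZero k}} → map (k *_) (divisors d) ⊆ divisors (k * d)
map-*-divisors⊆divisors {d} k x∈ with e , e∈ , refl ← ∈-map⁻ (k *_) x∈ =
  let instance _ = ∈-divisors⇒nonZero e∈
  in ∈-divisors⁺ {{m*n≢0 k d}} (*-monoʳ-∣ k (∈-divisors⁻ e∈))

map-*-divisors-unique : ∀ k .{{_ : NonZero k}} d → Unique (map (k *_) (divisors d))
map-*-divisors-unique k d = Unique.map⁺ (*-cancelˡ-≡ _ _ k) (divisors-unique d)

*σ≤σ* : ∀ k d .{{_ : NonZero k}} → k * σ d ≤ σ (k * d)
*σ≤σ* k d = begin
  k * σ d                       ≡⟨ sum-map-* k (divisors d) ⟨
  sum (map (k *_) (divisors d)) ≤⟨ sum-mono-⊆ (map-*-divisors-unique k d) (map-*-divisors⊆divisors k) ⟩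
  σ (k * d)                     ∎
  where open ≤-Reasoning

*σ<σ* : ∀ k d .{{_ : NonZero d}} → 1 < k → k * σ d < σ (k * d)
*σ<σ* k d 1<k = begin
  1 + k * σ d                       ≡⟨ cong suc (sum-map-* k (divisors d)) ⟨
  sum (1 ∷ map (k *_) (divisors d)) ≤⟨ sum-mono-⊆ (All.tabulate 1∉ ∷ map-*-divisors-unique k d) ⊆divisors ⟩
  σ (k * d)                         ∎
  where
  open ≤-Reasoning
  instance
    _ : NonZero k
    _ = >-nonZero (<-trans z<s 1<k)
  1∉ : ∀ {x} → x ∈ map (k *_) (divisors d) → 1 ≢ x
  1∉ x∈ 1≡x with e , _ , refl ← ∈-map⁻ (k *_) x∈ =
    <⇒≢ 1<k (sym (∣1⇒≡1 (divides e (trans 1≡x (*-comm k e)))))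
  ⊆divisors : 1 ∷ map (k *_) (divisors d) ⊆ divisors (k * d)
  ⊆divisors (here refl) = ∈-divisors⁺ {{m*n≢0 k d}} (1∣ _)
  ⊆divisors (there x∈) = map-*-divisors⊆divisors k x∈

6∣⇒2n≤σ : .{{NonZero n}} → 6 ∣ n → 2 * n ≤ σ n
6∣⇒2n≤σ {n} (divides q refl) = begin
  2 * (q * 6) ≡⟨ trans (*-comm 2 (q * 6)) (*-assoc q 6 2) ⟩
  q * 12      ≡⟨⟩
  q * σ 6     ≤⟨ *σ≤σ* q 6 {{m*n≢0⇒m≢0 q}} ⟩
  σ (q * 6)   ∎
  where open ≤-Reasoning

σ-even⇒3n<σσ : .{{NonZero n}} → 6 ∣ n → 2 ∣ σ n → 3 * n < σ (σ n)
σ-even⇒3n<σσ {n} 6∣n (divides t σn≡t*2) = begin-strict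
  3 * n     ≤⟨ *-monoʳ-≤ 3 n≤t ⟩
  3 * t     ≡⟨ *-comm 3 t ⟩
  t * 3     ≡⟨⟩
  t * σ 2   <⟨ *σ<σ* t 2 1<t ⟩
  σ (t * 2) ≡⟨ cong σ σn≡t*2 ⟨
  σ (σ n)   ∎
  where
  open ≤-Reasoning
  n≤t : n ≤ t
  n≤t = *-cancelˡ-≤ 2 (subst (2 * n ≤_) (trans σn≡t*2 (*-comm t 2)) (6∣⇒2n≤σ 6∣n))
  1<t : 1 < t
  1<t = <-≤-trans (∣⇒≤ (∣-trans (divides 3 refl) 6∣n)) n≤t

nearSuperperfect⇒σσ≤3n : .{{NonZero n}} → NearSuperperfect n → σ (σ n) ≤ 3 * n
nearSuperperfect⇒σσ≤3n {n} (d , _ , d∣n , 2n+d≡σσ) = begin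
  σ (σ n)   ≡⟨ 2n+d≡σσ ⟨
  2 * n + d ≤⟨ +-monoʳ-≤ (2 * n) (∣⇒≤ d∣n) ⟩
  2 * n + n ≡⟨ +-comm (2 * n) n ⟩
  3 * n     ∎
  where open ≤-Reasoning

deficientSuperperfect⇒σσ≤2n : DeficientSuperperfect n → σ (σ n) ≤ 2 * n
deficientSuperperfect⇒σσ≤2n {n} (d , _ , _ , 2n≡σσ+d) =
  ≤-trans (m≤m+n (σ (σ n)) d) (≤-reflexive (sym 2n≡σσ+d))

nearOrDeficientSuperperfect⇒σ-odd : .{{NonZero n}} → 6 ∣ n →
  NearSuperperfect n ⊎ DeficientSuperperfect n → ¬ 2 ∣ σ n
nearOrDeficientSuperperfect⇒σ-odd {n} 6∣n hyp 2∣σn = <⇒≱ (σ-even⇒3n<σσ 6∣n 2∣σn) (σσ≤3n hyp)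
  where
  σσ≤3n : NearSuperperfect n ⊎ DeficientSuperperfect n → σ (σ n) ≤ 3 * n
  σσ≤3n (inj₁ near)      = nearSuperperfect⇒σσ≤3n near
  σσ≤3n (inj₂ deficient) = ≤-trans (deficientSuperperfect⇒σσ≤2n deficient) (m≤n+m (2 * n) n)

odd? : Decidable (λ x → ¬ 2 ∣ x)
odd? x = ¬? (2 ∣? x)

odd⇒2∣suc : ¬ 2 ∣ x → 2 ∣ suc x
odd⇒2∣suc {zero} 2∤0 = contradiction (2 ∣0) 2∤0
odd⇒2∣suc {suc zero} _ = ∣-refl
odd⇒2∣suc {suc (suc x)} 2∤2+x = ∣m∣n⇒∣m+n ∣-refl (odd⇒2∣suc (2∤2+x ∘ ∣m∣n⇒∣m+n ∣-refl))

2∣odd+odd : ¬ 2 ∣ x → ¬ 2 ∣ y → 2 ∣ x + y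
2∣odd+odd {x} {y} 2∤x 2∤y = ∣m+n∣m⇒∣n 2∣2+x+y ∣-refl
  where
  2∣2+x+y : 2 ∣ 2 + (x + y)
  2∣2+x+y = subst (2 ∣_) (cong suc (+-suc x y)) (∣m∣n⇒∣m+n (odd⇒2∣suc 2∤x) (odd⇒2∣suc 2∤y))

2∣sum-odd+sum : ∀ xs → 2 ∣ sum (filter odd? xs) + sum xs
2∣sum-odd+sum [] = 2 ∣0
2∣sum-odd+sum (x ∷ xs) with 2 ∣? x
... | yes 2∣x rewrite filter-reject odd? {xs = xs} (λ 2∤x → 2∤x 2∣x) =
  subst (2 ∣_) (x∙yz≈y∙xz x _ (sum xs)) (∣m∣n⇒∣m+n 2∣x (2∣sum-odd+sum xs))
... | no 2∤x rewrite filter-accept odd? {xs = xs} 2∤x =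
  subst (2 ∣_) (interchange x x _ (sum xs)) (∣m∣n⇒∣m+n (2∣odd+odd 2∤x 2∤x) (2∣sum-odd+sum xs))

-- d divides ((d + 1)/2)·2x = d·x + x.
odd∣2*⇒∣ : ¬ 2 ∣ d → d ∣ 2 * x → d ∣ x
odd∣2*⇒∣ {d} {x} 2∤d d∣2x with divides j 1+d≡j*2 ← odd⇒2∣suc 2∤d = ∣m+n∣m⇒∣n d∣dx+x (m∣m*n x)
  where
  open ≡-Reasoning
  d∣dx+x : d ∣ d * x + x
  d∣dx+x = subst (d ∣_) j*2x≡dx+x (∣n⇒∣m*n j d∣2x)
    where
    j*2x≡dx+x : j * (2 * x) ≡ d * x + x
    j*2x≡dx+x = begin
      j * (2 * x)   ≡⟨ *-assoc j 2 x ⟨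
      j * 2 * x     ≡⟨ cong (_* x) 1+d≡j*2 ⟨
      x + d * x     ≡⟨ +-comm x (d * x) ⟩
      d * x + x     ∎

odd∣2^m*⇒∣ : ∀ m → ¬ 2 ∣ d → d ∣ 2 ^ m * x → d ∣ x
odd∣2^m*⇒∣ {d} {x} zero _ d∣1*x = subst (d ∣_) (*-identityˡ x) d∣1*x
odd∣2^m*⇒∣ {d} {x} (suc m) 2∤d d∣2^[1+m]*x =
  odd∣2^m*⇒∣ m 2∤d (odd∣2*⇒∣ 2∤d (subst (d ∣_) (*-assoc 2 (2 ^ m) x) d∣2^[1+m]*x))

oddPart : ∀ n .{{_ : NonZero n}} → ∃₂ λ m a → ¬ 2 ∣ a × n ≡ 2 ^ m * a
oddPart n = go n (<-wellFounded n)
  where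
  go : ∀ n .{{_ : NonZero n}} → Acc _<_ n → ∃₂ λ m a → ¬ 2 ∣ a × n ≡ 2 ^ m * a
  go n (acc rs) with 2 ∣? n
  ... | no 2∤n = 0 , n , 2∤n , sym (*-identityˡ n)
  ... | yes (divides q refl) =
    let instance _ = m*n≢0⇒m≢0 q
        m , a , 2∤a , q≡2^m*a = go q (rs (m<m*n q 2 (s≤s (s≤s z≤n))))
    in suc m , a , 2∤a ,
       trans (cong (_* 2) q≡2^m*a) (trans (*-comm (2 ^ m * a) 2) (sym (*-assoc 2 (2 ^ m) a)))

2∣2^m*odd⇒1≤m : ¬ 2 ∣ a → 2 ∣ 2 ^ m * a → 1 ≤ m
2∣2^m*odd⇒1≤m {a} {zero} 2∤a 2∣1*a = contradiction (subst (2 ∣_) (*-identityˡ a) 2∣1*a) 2∤a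
2∣2^m*odd⇒1≤m {m = suc _} _ _ = s≤s z≤n

module Codivisor (a : ℕ) .{{_ : NonZero a}} where

  -- The value at 0 is junk: 0 never divides a.
  codivisor : ℕ → ℕ
  codivisor zero = zero
  codivisor d@(suc _) = a / d

  *-codivisor : d ∣ a → d * codivisor d ≡ a
  *-codivisor {zero} 0∣a = contradiction (0∣⇒≡0 0∣a) (≢-nonZero⁻¹ a)
  *-codivisor {suc _} d∣a = m*[n/m]≡n d∣a

  codivisor-∣ : d ∣ a → codivisor d ∣ a
  codivisor-∣ {d} d∣a = divides d (sym (*-codivisor d∣a))

  codivisor-unique : d * e ≡ a → codivisor e ≡ d
  codivisor-unique {d} {zero} d*0≡a = contradiction (trans (sym d*0≡a) (*-zeroʳ d)) (≢-nonZero⁻¹ a)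
  codivisor-unique {d} {suc e} d*e≡a = trans (cong (_/ suc e) (sym d*e≡a)) (m*n/n≡m d (suc e))

  codivisor-involutive : d ∣ a → codivisor (codivisor d) ≡ d
  codivisor-involutive d∣a = codivisor-unique (*-codivisor d∣a)

odd⇒nonZero : ¬ 2 ∣ a → NonZero a
odd⇒nonZero {zero} 2∤0 = contradiction (2 ∣0) 2∤0
odd⇒nonZero {suc _} _ = _

module OddDivisors (m : ℕ) {a : ℕ} (2∤a : ¬ 2 ∣ a) where
  instance
    a≢0 : NonZero a
    a≢0 = odd⇒nonZero 2∤a

  open Codivisor a

  oddDivisors : List ℕ
  oddDivisors = filter odd? (divisors (2 ^ m * a))

  ∈-oddDivisors⁺ : d ∣ a → d ∈ oddDivisors
  ∈-oddDivisors⁺ d∣a = ∈-filter⁺ odd? (∈-divisors⁺ {{m*n≢0 (2 ^ m) a {{m^n≢0 2 m}}}} (∣n⇒∣m*n (2 ^ m) d∣a))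
                                      (λ 2∣d → 2∤a (∣-trans 2∣d d∣a))

  ∈-oddDivisors⁻ : d ∈ oddDivisors → ¬ 2 ∣ d × d ∣ a
  ∈-oddDivisors⁻ d∈ with d∈divisors , 2∤d ← ∈-filter⁻ odd? {xs = divisors (2 ^ m * a)} d∈ =
    2∤d , odd∣2^m*⇒∣ m 2∤d (∈-divisors⁻ d∈divisors)

  codivisor-∈ : d ∈ oddDivisors → codivisor d ∈ oddDivisors
  codivisor-∈ = ∈-oddDivisors⁺ ∘ codivisor-∣ ∘ proj₂ ∘ ∈-oddDivisors⁻

  2∣sum-oddDivisors : (∀ {d} → d ∈ oddDivisors → d * d ≢ a) → 2 ∣ sum oddDivisors
  2∣sum-oddDivisors noSquare =
    2∣sum-of-pairs (Unique.filter⁺ odd? (divisors-unique (2 ^ m * a))) involution 2∣d+codivisor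
    where
    involution : FixedPointFreeInvolution codivisor oddDivisors
    involution = record
      { closed         = codivisor-∈
      ; involutive     = codivisor-involutive ∘ proj₂ ∘ ∈-oddDivisors⁻
      ; fixedPointFree = λ {d} d∈ codivisor-d≡d →
          noSquare d∈ (trans (cong (d *_) (sym codivisor-d≡d)) (*-codivisor (proj₂ (∈-oddDivisors⁻ d∈))))
      }
    2∣d+codivisor : ∀ {d} → d ∈ oddDivisors → 2 ∣ d + codivisor d
    2∣d+codivisor d∈ = 2∣odd+odd (proj₁ (∈-oddDivisors⁻ d∈)) (proj₁ (∈-oddDivisors⁻ (codivisor-∈ d∈)))

σ-odd⇒oddPart-square : ∀ m → ¬ 2 ∣ a → ¬ 2 ∣ σ (2 ^ m * a) → ∃ λ k → a ≡ k * k
σ-odd⇒oddPart-square {a} m 2∤a 2∤σ with any? (λ d → d * d ≟ a) (OddDivisors.oddDivisors m 2∤a)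
... | yes square = map₂ sym (satisfied square)
... | no noSquare = contradiction 2∣σ 2∤σ
  where
  open OddDivisors m 2∤a
  2∣σ : 2 ∣ σ (2 ^ m * a)
  2∣σ = ∣m+n∣m⇒∣n (2∣sum-odd+sum (divisors (2 ^ m * a))) (2∣sum-oddDivisors (λ d∈ → noSquare ∘ lose d∈))

mainTheorem13 : (n : ℕ) → 0 < n → 6 ∣ n → NearSuperperfect n ⊎ DeficientSuperperfect n →
    Σ ℕ λ m → Σ ℕ λ a → (1 ≤ m) × (¬ (2 ∣ a)) × (Σ ℕ λ k → a ≡ k * k) × (n ≡ 2 ^ m * a)
mainTheorem13 n 0<n 6∣n hyp with m , a , 2∤a , refl ← oddPart n {{>-nonZero 0<n}} =
  m , a , 2∣2^m*odd⇒1≤m 2∤a 2∣n , 2∤a , σ-odd⇒oddPart-square m 2∤a σn-odd , refl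
  where
  instance
    _ : NonZero n
    _ = >-nonZero 0<n
  2∣n : 2 ∣ n
  2∣n = ∣-trans (divides 3 refl) 6∣n
  σn-odd : ¬ 2 ∣ σ n
  σn-odd = nearOrDeficientSuperperfect⇒σ-odd 6∣n hyp
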